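{- Let $A=(10,15,21)$ (the triangular numbers $t_4,t_5,t_6$), with elements $m_i^{(p)}$ ($0\le i\le 9$) taken with respect to the smallest generator $a_1=10$. For nonnegative integers $n,j$ put $$ r_e=\frac{n(7 n+8-2 j)}{4},\qquad r_o=\frac{7 n^2+(8-4 j)n+1}{4},\qquad r_{oo}=\frac{7 n^2+(2-4 j)n-1}{4}. $$ (a) If $n$ is even and either ($n\ge 0$ and $j=0$) or ($n\ge 2$ and $j\in\{2,4,6,8\}$), then \begin{align*} &m_9^{(r_e)}=105 n+99-15 j,\ m_4^{(r_e)}=105 n+84-15 j,\ m_8^{(r_e)}=105 n+78-15 j,\ m_3^{(r_e)}=105 n+63-15 j,\\ &m_7^{(r_e)}=105 n+57-15 j,\ m_2^{(r_e)}=105 n+42-15 j,\ m_6^{(r_e)}=105 n+36-15 j,\ m_1^{(r_e)}=105 n+21-15 j,\\ &m_5^{(r_e)}=105 n+15-15 j,\ m_0^{(r_e)}=105 n-15 j. \end{align*} (b) If $n\ge 2$ is even and $j\in\{3,5\}$, then \begin{align*} &m_4^{(r_e)}=105 n+99-15 j,\ m_9^{(r_e)}=105 n+84-15 j,\ m_3^{(r_e)}=105 n+78-15 j,\ m_8^{(r_e)}=105 n+63-15 j,\\ &m_2^{(r_e)}=105 n+57-15 j,\ m_7^{(r_e)}=105 n+42-15 j,\ m_1^{(r_e)}=105 n+36-15 j,\ m_6^{(r_e)}=105 n+21-15 j,\\ &m_0^{(r_e)}=105 n+15-15 j,\ m_5^{(r_e)}=105 n-15 j. \end{align*} (c) If $n$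 is odd and either ($n\ge 1$ and $j=0$) or ($n\ge 3$ and $j\in\{1,2,3,4\}$), then \begin{align*} &m_4^{(r_o)}=105 n+99-30 j,\ m_9^{(r_o)}=105 n+84-30 j,\ m_3^{(r_o)}=105 n+78-30 j,\ m_8^{(r_o)}=105 n+63-30 j,\\ &m_2^{(r_o)}=105 n+57-30 j,\ m_7^{(r_o)}=105 n+42-30 j,\ m_1^{(r_o)}=105 n+36-30 j,\ m_6^{(r_o)}=105 n+21-30 j,\\ &m_0^{(r_o)}=105 n+15-30 j,\ m_5^{(r_o)}=105 n-30 j. \end{align*} (d) If $n\ge 1$ is odd and $j\in\{0,1\}$, then \begin{align*} &m_9^{(r_{oo})}=105 n+54-30 j,\ m_4^{(r_{oo})}=105 n+39-30 j,\ m_8^{(r_{oo})}=105 n+33-30 j,\ m_3^{(r_{oo})}=105 n+18-30 j,\\ &m_7^{(r_{oo})}=105 n+12-30 j,\ m_2^{(r_{oo})}=105 n-3-30 j,\ m_6^{(r_{oo})}=105 n-9-30 j,\ m_1^{(r_{oo})}=105 n-24-30 j,\\ &m_5^{(r_{oo})}=105 n-30-30 j,\ m_0^{(r_{oo})}=105 n-45-30 j. \end{align*}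
   Context: For positive integers $a_1<a_2<\dots<a_k$ with $\gcd(a_1,\dots,a_k)=1$ and an integer $N$, let $d(N;a_1,\dots,a_k)$ denote the number of $k$-tuples $(x_1,\dots,x_k)$ of nonnegative integers with $a_1x_1+\cdots+a_kx_k=N$ (so $d(N;\cdot)=0$ for $N<0$). For a nonnegative integer $p$ and $0\le i\le a_1-1$, $m_i^{(p)}$ denotes the (unique) nonnegative integer $M$ with $M\equiv i\pmod{a_1}$, $d(M;a_1,\dots,a_k)\ge p+1$ and $d(M-a_1;a_1,\dots,a_k)\le p$; equivalently, the least nonnegative integer congruent to $i$ modulo $a_1$ having at least $p+1$ representations. -}

module Defs where

open import Data.Nat using (ℕ; zero; suc; _+_; _*_; _∸_; _≤_; _<_; _≟_)
open import Data.Nat.DivMod using (_%_)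
open import Data.List using (List; length; filter; upTo; concatMap; map; _∷_; [])
open import Data.Product using (_×_; _,_)
open import Relation.Binary.PropositionalEquality using (_≡_)

triplesUpTo : ℕ → List (ℕ × ℕ × ℕ)
triplesUpTo N =
  concatMap (λ x → concatMap (λ y → map (λ z → (x , y , z)) (upTo (suc N)))
                             (upTo (suc N)))
            (upTo (suc N))

-- d(N; 10, 15, 21): number of (x₁,x₂,x₃) ∈ ℕ³ with 10x₁ + 15x₂ + 21x₃ = N.
-- (Any solution has every coordinate ≤ N, so enumerating triplesUpTo N is exhaustive.)
d : ℕ → ℕ
d N = length (filter (λ { (x , y , z) → 10 * x + 15 * y + 21 * z ≟ N }) (triplesUpTo N))

-- IsM i p M  :  M = m_i^{(p)} w.r.t. A = (10,15,21), a₁ = 10, i.e.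
-- M ≡ i (mod 10), d(M) ≥ p+1 and d(M − 10) ≤ p  (d of a negative number is 0,
-- so the last condition is only imposed when M ≥ 10).
IsM : ℕ → ℕ → ℕ → Set
IsM i p M = (M % 10 ≡ i) × (suc p ≤ d M) × (10 ≤ M → d (M ∸ 10) ≤ p)

-- Adjoining a generator a turns the representation count d(·; A) into d(·; A, a) with
-- d(N + a; A, a) = d(N + a; A) + d(N; A, a). Iterating, d(210 + N) = Δ N + d N where
-- Δ N = Σ_{m=1..21} d(10 m + N; 15, 21), and Δ (210 + N) = Δ N + 14, since 21 divides
-- 10 m + 15 t + N for exactly 14 pairs (m , t) ∈ [1, 21] × [1, 14]. Along a progression
-- 210 k + c the count is therefore the quadratic d c + k (Δ c − 7) + 7 k², so the values of
-- d and Δ at c and c − 10 certify 210 k + c = m_i^{(p)} with p = 7 k² + β k + γ for every k.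
-- Writing n = 2 k + r makes each claim ten such progressions; n = 0 and n = 1 lie before
-- their starting points and are checked by direct computation.

module Submission where

open import Defs
open import Data.Nat using (ℕ; zero; suc; _+_; _*_; _∸_; _≤_; _<_; _≟_; _≤?_; _<?_; z≤n; s≤s; NonZero; >-nonZero⁻¹)
open import Data.Nat.Properties
open import Data.Nat.DivMod using (_/_; _%_; m≡m%n+[m/n]*n; m%n<n; [m+kn]%n≡m%n; m*n/n≡m; m<n*o⇒m/o<n; [m+n]%n≡m%n)
open import Data.Nat.ListAction using (sum)
open import Data.List using (List; []; _∷_; length; filter; map; concatMap; applyUpTo; upTo; _++_)
open import Data.List.Properties using (length-++; filter-++; map-upTo)
import Data.List.Relation.Unary.All as All
open All using ([]; _∷_)
open import Data.List.NonEmpty using (List⁺; _∷_; foldr; toList)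
open import Data.Product using (_×_; _,_; ∃-syntax)
open import Data.Sum using (_⊎_; inj₁; inj₂)
open import Relation.Binary.PropositionalEquality
open import Relation.Nullary using (Dec; yes; no; contradiction)
open import Relation.Nullary.Decidable using (True; toWitness; map′; _×-dec_; _→-dec_)
open import Relation.Unary using (Decidable)
open import Data.Unit using (tt)
open import Data.Nat.Tactic.RingSolver using (solve-∀)

𝟙 : ∀ {a} {A : Set a} → Dec A → ℕ
𝟙 (yes _) = 1
𝟙 (no  _) = 0

𝟙-cong : ∀ {a b} {A : Set a} {B : Set b} → (A → B) → (B → A) → (a? : Dec A) (b? : Dec B) → 𝟙 a? ≡ 𝟙 b?
𝟙-cong A→B B→A (yes a) (yes b) = refl
𝟙-cong A→B B→A (yes a) (no ¬b) = contradiction (A→B a) ¬b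
𝟙-cong A→B B→A (no ¬a) (yes b) = contradiction (B→A b) ¬a
𝟙-cong A→B B→A (no ¬a) (no ¬b) = refl

∑ : ℕ → (ℕ → ℕ) → ℕ
∑ n f = sum (applyUpTo f n)

∑-cong : ∀ n {f g : ℕ → ℕ} → (∀ i → f i ≡ g i) → ∑ n f ≡ ∑ n g
∑-cong zero    f≗g = refl
∑-cong (suc n) f≗g = cong₂ _+_ (f≗g 0) (∑-cong n (λ i → f≗g (suc i)))

∑-distrib-+ : ∀ n (f g : ℕ → ℕ) → ∑ n (λ i → f i + g i) ≡ ∑ n f + ∑ n g
∑-distrib-+ zero    f g = refl
∑-distrib-+ (suc n) f g =
  trans (cong (f 0 + g 0 +_) (∑-distrib-+ n (λ i → f (suc i)) (λ i → g (suc i))))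
        (+-interchange (f 0) (g 0) _ _)
  where
  +-interchange : ∀ a b c d → (a + b) + (c + d) ≡ (a + c) + (b + d)
  +-interchange = solve-∀

∑-vanishing : ∀ n {f : ℕ → ℕ} → (∀ i → f i ≡ 0) → ∑ n f ≡ 0
∑-vanishing zero    f≗0 = refl
∑-vanishing (suc n) f≗0 = cong₂ _+_ (f≗0 0) (∑-vanishing n (λ i → f≗0 (suc i)))

∑-truncate : ∀ {m n} (f : ℕ → ℕ) → m ≤ n → (∀ i → m ≤ i → f i ≡ 0) → ∑ n f ≡ ∑ m f
∑-truncate {zero}  {n}     f _         vanish = ∑-vanishing n (λ i → vanish i z≤n)
∑-truncate {suc m} {suc n} f (s≤s m≤n) vanish =
  cong (f 0 +_) (∑-truncate (λ i → f (suc i)) m≤n (λ i m≤i → vanish (suc i) (s≤s m≤i)))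

module _ {a p} {A : Set a} {P : A → Set p} (P? : Decidable P) where

  count-∷ : ∀ x xs → length (filter P? (x ∷ xs)) ≡ 𝟙 (P? x) + length (filter P? xs)
  count-∷ x xs with P? x
  ... | yes _ = refl
  ... | no  _ = refl

  count-map : ∀ {b} {B : Set b} (g : B → A) xs →
              length (filter P? (map g xs)) ≡ sum (map (λ x → 𝟙 (P? (g x))) xs)
  count-map g []       = refl
  count-map g (x ∷ xs) = trans (count-∷ (g x) (map g xs)) (cong (𝟙 (P? (g x)) +_) (count-map g xs))

  count-concatMap : ∀ {b} {B : Set b} (g : B → List A) xs →
                    length (filter P? (concatMap g xs)) ≡ sum (map (λ x → length (filter P? (g x))) xs)
  count-concatMap g []       = refl
  count-concatMap g (x ∷ xs) = begin
    length (filter P? (g x ++ concatMap g xs))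
      ≡⟨ cong length (filter-++ P? (g x) (concatMap g xs)) ⟩
    length (filter P? (g x) ++ filter P? (concatMap g xs))
      ≡⟨ length-++ (filter P? (g x)) ⟩
    length (filter P? (g x)) + length (filter P? (concatMap g xs))
      ≡⟨ cong (length (filter P? (g x)) +_) (count-concatMap g xs) ⟩
    length (filter P? (g x)) + sum (map (λ x → length (filter P? (g x))) xs) ∎
    where open ≡-Reasoning

  count-map-upTo : ∀ (g : ℕ → A) n → length (filter P? (map g (upTo n))) ≡ ∑ n (λ i → 𝟙 (P? (g i)))
  count-map-upTo g n = trans (count-map g (upTo n)) (cong sum (map-upTo (λ i → 𝟙 (P? (g i))) n))

  count-concatMap-upTo : ∀ (g : ℕ → List A) n →
                         length (filter P? (concatMap g (upTo n))) ≡ ∑ n (λ i → length (filter P? (g i)))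
  count-concatMap-upTo g n =
    trans (count-concatMap g (upTo n)) (cong sum (map-upTo (λ i → length (filter P? (g i))) n))

count-triples : ∀ {p} {P : ℕ × ℕ × ℕ → Set p} (P? : Decidable P) B →
  length (filter P? (concatMap (λ x → concatMap (λ y → map (λ z → (x , y , z)) (upTo B)) (upTo B)) (upTo B)))
    ≡ ∑ B (λ x → ∑ B (λ y → ∑ B (λ z → 𝟙 (P? (x , y , z)))))
count-triples P? B =
  trans (count-concatMap-upTo P? _ B) (∑-cong B λ x →
  trans (count-concatMap-upTo P? _ B) (∑-cong B λ y →
  count-map-upTo P? _ B))

d-as-∑ : ∀ N → d N ≡ ∑ (suc N) (λ x → ∑ (suc N) (λ y → ∑ (suc N) (λ z → 𝟙 (10 * x + 15 * y + 21 * z ≟ N))))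
d-as-∑ N = count-triples (λ { (x , y , z) → 10 * x + 15 * y + 21 * z ≟ N }) (suc N)

-- In generating-function terms, shift m g is x^m · g and adjoin a g is g / (1 − x^a).
shift : ℕ → (ℕ → ℕ) → ℕ → ℕ
shift m g N with m ≤? N
... | yes _ = g (N ∸ m)
... | no  _ = 0

shift-≤ : ∀ {m N} g → m ≤ N → shift m g N ≡ g (N ∸ m)
shift-≤ {m} {N} g m≤N with m ≤? N
... | yes _   = refl
... | no  m≰N = contradiction m≤N m≰N

shift-> : ∀ {m N} g → N < m → shift m g N ≡ 0
shift-> {m} {N} g N<m with m ≤? N
... | yes m≤N = contradiction m≤N (<⇒≱ N<m)
... | no  _   = refl

shift-+ : ∀ k m g N → shift (k + m) g (k + N) ≡ shift m g N
shift-+ k m g N with ≤-<-connex m N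
... | inj₁ m≤N = trans (shift-≤ g (+-monoʳ-≤ k m≤N))
                      (trans (cong g ([m+n]∸[m+o]≡n∸o k N m)) (sym (shift-≤ g m≤N)))
... | inj₂ N<m = trans (shift-> g (+-monoʳ-< k N<m)) (sym (shift-> g N<m))

shift-shift : ∀ c m g N → shift (c + m) g N ≡ shift c (shift m g) N
shift-shift c m g N with ≤-<-connex c N
... | inj₁ c≤N = trans (cong (shift (c + m) g) (sym (m+[n∸m]≡n c≤N)))
                      (trans (shift-+ c m g (N ∸ c)) (sym (shift-≤ (shift m g) c≤N)))
... | inj₂ N<c = trans (shift-> g (<-≤-trans N<c (m≤m+n c m))) (sym (shift-> (shift m g) N<c))

shift-cong : ∀ c {g h} N → g (N ∸ c) ≡ h (N ∸ c) → shift c g N ≡ shift c h N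
shift-cong c {g} {h} N eq with ≤-<-connex c N
... | inj₁ c≤N = trans (shift-≤ g c≤N) (trans eq (sym (shift-≤ h c≤N)))
... | inj₂ N<c = trans (shift-> g N<c) (sym (shift-> h N<c))

∑-shift : ∀ B c (h : ℕ → ℕ → ℕ) N → ∑ B (λ x → shift c (h x) N) ≡ shift c (λ M → ∑ B (λ x → h x M)) N
∑-shift B c h N with ≤-<-connex c N
... | inj₁ c≤N = trans (∑-cong B (λ x → shift-≤ (h x) c≤N)) (sym (shift-≤ (λ M → ∑ B (λ x → h x M)) c≤N))
... | inj₂ N<c = trans (∑-vanishing B (λ x → shift-> (h x) N<c)) (sym (shift-> _ N<c))

adjoin : ∀ a .{{_ : NonZero a}} → (ℕ → ℕ) → ℕ → ℕ
adjoin a g N = ∑ (suc (N / a)) (λ x → shift (a * x) g N)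

adjoin-bound : ∀ a .{{_ : NonZero a}} g {N B} → N < B → ∑ B (λ x → shift (a * x) g N) ≡ adjoin a g N
adjoin-bound a g {N} {B} N<B =
  ∑-truncate {suc (N / a)} {B} (λ x → shift (a * x) g N)
    (m<n*o⇒m/o<n (<-≤-trans N<B (m≤m*n B a)))
    (λ x N/a<x → shift-> g (<-≤-trans N<a*[1+N/a] (*-monoʳ-≤ a N/a<x)))
  where
  N<a*[1+N/a] : N < a * suc (N / a)
  N<a*[1+N/a] = begin-strict
    N                         ≡⟨ m≡m%n+[m/n]*n N a ⟩
    N % a + N / a * a         <⟨ +-monoˡ-< (N / a * a) (m%n<n N a) ⟩
    a + N / a * a             ≡⟨ trans (cong (a +_) (*-comm (N / a) a)) (sym (*-suc a (N / a))) ⟩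
    a * suc (N / a)           ∎
    where open ≤-Reasoning

adjoin-step : ∀ a .{{_ : NonZero a}} g N → adjoin a g (a + N) ≡ g (a + N) + adjoin a g N
adjoin-step a g N = begin
  adjoin a g (a + N)
    ≡⟨ adjoin-bound a g (n<1+n (a + N)) ⟨
  shift (a * 0) g (a + N) + ∑ (a + N) (λ x → shift (a * suc x) g (a + N))
    ≡⟨ cong₂ _+_ (cong (λ m → shift m g (a + N)) (*-zeroʳ a))
                 (∑-cong (a + N) (λ x → trans (cong (λ m → shift m g (a + N)) (*-suc a x)) (shift-+ a (a * x) g N))) ⟩
  g (a + N) + ∑ (a + N) (λ x → shift (a * x) g N)
    ≡⟨ cong (g (a + N) +_) (adjoin-bound a g (m<n+m N (>-nonZero⁻¹ a))) ⟩
  g (a + N) + adjoin a g N ∎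
  where open ≡-Reasoning

∑-shift-adjoin : ∀ a .{{_ : NonZero a}} g c {N B} → N < B →
                 ∑ B (λ x → shift (c + a * x) g N) ≡ shift c (adjoin a g) N
∑-shift-adjoin a g c {N} {B} N<B = begin
  ∑ B (λ x → shift (c + a * x) g N)            ≡⟨ ∑-cong B (λ x → shift-shift c (a * x) g N) ⟩
  ∑ B (λ x → shift c (shift (a * x) g) N)      ≡⟨ ∑-shift B c (λ x → shift (a * x) g) N ⟩
  shift c (λ M → ∑ B (λ x → shift (a * x) g M)) N
    ≡⟨ shift-cong c N (adjoin-bound a g (≤-<-trans (m∸n≤m N c) N<B)) ⟩
  shift c (adjoin a g) N                       ∎
  where open ≡-Reasoning


telescope : ∀ a (u g : ℕ → ℕ) → (∀ N → u (a + N) ≡ g (a + N) + u N) →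
            ∀ t N → u (a * t + N) ≡ ∑ t (λ m → g (a * suc m + N)) + u N
telescope a u g step zero    N = cong (λ x → u (x + N)) (*-zeroʳ a)
telescope a u g step (suc t) N = begin
  u (a * suc t + N)
    ≡⟨ cong u (shuffle a t N) ⟩
  u (a * t + (a + N))
    ≡⟨ telescope a u g step t (a + N) ⟩
  ∑ t (λ m → g (a * suc m + (a + N))) + u (a + N)
    ≡⟨ cong₂ _+_ (∑-cong t (λ m → cong g (shuffle′ a m N))) (step N) ⟩
  later + (g (a + N) + u N)
    ≡⟨ +-interchange later (g (a + N)) (u N) ⟩
  (g (a + N) + later) + u N
    ≡⟨ cong (λ x → (g x + later) + u N) (shuffle″ a N) ⟩
  (g (a * 1 + N) + later) + u N ∎
  where
  open ≡-Reasoning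
  later = ∑ t (λ m → g (a * suc (suc m) + N))
  shuffle : ∀ a t N → a * suc t + N ≡ a * t + (a + N)
  shuffle = solve-∀
  shuffle′ : ∀ a m N → a * suc m + (a + N) ≡ a * suc (suc m) + N
  shuffle′ = solve-∀
  shuffle″ : ∀ a N → a + N ≡ a * 1 + N
  shuffle″ = solve-∀
  +-interchange : ∀ x y z → x + (y + z) ≡ (y + x) + z
  +-interchange = solve-∀

periodic-mod : ∀ p .{{_ : NonZero p}} (h : ℕ → ℕ) → (∀ N → h (p + N) ≡ h N) → ∀ N → h N ≡ h (N % p)
periodic-mod p h period N = begin
  h N                          ≡⟨ cong h (m≡m%n+[m/n]*n N p) ⟩
  h (N % p + N / p * p)        ≡⟨ cong h (+-comm (N % p) (N / p * p)) ⟩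
  h (N / p * p + N % p)        ≡⟨ multiples (N / p) (N % p) ⟩
  h (N % p)                    ∎
  where
  open ≡-Reasoning
  multiples : ∀ q r → h (q * p + r) ≡ h r
  multiples zero    r = refl
  multiples (suc q) r = trans (cong h (+-assoc p (q * p) r)) (trans (period _) (multiples q r))

-- dₖ N = d(N; ∅), d(N; 21), d(N; 15, 21), d(N; 10, 15, 21) for k = 0, 1, 2, 3; d₁ is given in
-- closed form (justified by d₁-as-adjoin) so that the certificates below evaluate quickly.
d₀ d₁ d₂ d₃ : ℕ → ℕ
d₀ N = 𝟙 (N ≟ 0)
d₁ N = 𝟙 (N % 21 ≟ 0)
d₂ = adjoin 15 d₁
d₃ = adjoin 10 d₂

d₁-as-adjoin : ∀ N → adjoin 21 d₀ N ≡ d₁ N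
d₁-as-adjoin N = trans (periodic-mod 21 (adjoin 21 d₀) (adjoin-step 21 d₀) N) (on-residues (m%n<n N 21))
  where
  on-residues : ∀ {r} → r < 21 → adjoin 21 d₀ r ≡ 𝟙 (r ≟ 0)
  on-residues = toWitness {a? = allUpTo? (λ r → adjoin 21 d₀ r ≟ 𝟙 (r ≟ 0)) 21} tt

d₁-period : ∀ K → d₁ (21 + K) ≡ d₁ K
d₁-period K = cong (λ r → 𝟙 (r ≟ 0)) (trans (cong (_% 21) (+-comm 21 K)) ([m+n]%n≡m%n K 21))

𝟙-≟-shift : ∀ m N → 𝟙 (m ≟ N) ≡ shift m d₀ N
𝟙-≟-shift m N with ≤-<-connex m N
... | inj₁ m≤N =
  trans (𝟙-cong (λ { refl → n∸n≡0 m }) (λ N∸m≡0 → ≤-antisym m≤N (m∸n≡0⇒m≤n N∸m≡0)) (m ≟ N) (N ∸ m ≟ 0))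
        (sym (shift-≤ _ m≤N))
... | inj₂ N<m = trans (𝟙-cong (λ { refl → <-irrefl refl N<m }) (λ ()) (m ≟ N) (no λ ()))
                       (sym (shift-> _ N<m))

d≡d₃ : ∀ N → d N ≡ d₃ N
d≡d₃ N = begin
  d N
    ≡⟨ d-as-∑ N ⟩
  ∑ (suc N) (λ x → ∑ (suc N) (λ y → ∑ (suc N) (λ z → 𝟙 (10 * x + 15 * y + 21 * z ≟ N))))
    ≡⟨ ∑-cong (suc N) (λ x → ∑-cong (suc N) (λ y → innermost (10 * x + 15 * y))) ⟩
  ∑ (suc N) (λ x → ∑ (suc N) (λ y → shift (10 * x + 15 * y) d₁ N))
    ≡⟨ ∑-cong (suc N) (λ x → ∑-shift-adjoin 15 d₁ (10 * x) (n<1+n N)) ⟩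
  ∑ (suc N) (λ x → shift (10 * x) d₂ N)
    ≡⟨ ∑-shift-adjoin 10 d₂ 0 (n<1+n N) ⟩
  d₃ N ∎
  where
  open ≡-Reasoning
  innermost : ∀ c → ∑ (suc N) (λ z → 𝟙 (c + 21 * z ≟ N)) ≡ shift c d₁ N
  innermost c = begin
    ∑ (suc N) (λ z → 𝟙 (c + 21 * z ≟ N))       ≡⟨ ∑-cong (suc N) (λ z → 𝟙-≟-shift (c + 21 * z) N) ⟩
    ∑ (suc N) (λ z → shift (c + 21 * z) d₀ N)   ≡⟨ ∑-shift-adjoin 21 d₀ c (n<1+n N) ⟩
    shift c (adjoin 21 d₀) N                    ≡⟨ shift-cong c N (d₁-as-adjoin (N ∸ c)) ⟩
    shift c d₁ N                                ∎

Δ : ℕ → ℕ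
Δ N = ∑ 21 (λ m → d₂ (10 * suc m + N))

d₃-period : ∀ N → d₃ (210 + N) ≡ Δ N + d₃ N
d₃-period = telescope 10 d₃ d₂ (adjoin-step 10 d₂) 21

S : ℕ → ℕ
S N = ∑ 21 (λ m → ∑ 14 (λ t → d₁ (15 * suc t + (10 * suc m + N))))

S-period : ∀ N → S (21 + N) ≡ S N
S-period N = ∑-cong 21 λ m → ∑-cong 14 λ t →
  trans (cong d₁ (shuffle t m N)) (d₁-period (15 * suc t + (10 * suc m + N)))
  where
  shuffle : ∀ t m N → 15 * suc t + (10 * suc m + (21 + N)) ≡ 21 + (15 * suc t + (10 * suc m + N))
  shuffle = solve-∀

S≡14 : ∀ N → S N ≡ 14
S≡14 N = trans (periodic-mod 21 S S-period N) (on-residues (m%n<n N 21))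
  where
  on-residues : ∀ {r} → r < 21 → S r ≡ 14
  on-residues = toWitness {a? = allUpTo? (λ r → S r ≟ 14) 21} tt

Δ-period : ∀ N → Δ (210 + N) ≡ Δ N + 14
Δ-period N = begin
  Δ (210 + N)
    ≡⟨ ∑-cong 21 (λ m → trans (cong d₂ (shuffle m N)) (d₂-telescope (10 * suc m + N))) ⟩
  ∑ 21 (λ m → ∑ 14 (λ t → d₁ (15 * suc t + (10 * suc m + N))) + d₂ (10 * suc m + N))
    ≡⟨ ∑-distrib-+ 21 (λ m → ∑ 14 (λ t → d₁ (15 * suc t + (10 * suc m + N)))) (λ m → d₂ (10 * suc m + N)) ⟩
  S N + Δ N
    ≡⟨ trans (cong (_+ Δ N) (S≡14 N)) (+-comm 14 (Δ N)) ⟩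
  Δ N + 14 ∎
  where
  open ≡-Reasoning
  shuffle : ∀ m N → 10 * suc m + (210 + N) ≡ 15 * 14 + (10 * suc m + N)
  shuffle = solve-∀
  d₂-telescope = telescope 15 d₂ d₁ (adjoin-step 15 d₁) 14

module ConstantSecondDifference (a : ℕ) (u v : ℕ → ℕ)
  (u-step : ∀ k → u (suc k) ≡ v k + u k) (v-step : ∀ k → v (suc k) ≡ v k + 2 * a) where

  v-linear : ∀ k → v k ≡ v 0 + 2 * a * k
  v-linear zero    = sym (identity (v 0) (2 * a))
    where
    identity : ∀ x y → x + y * 0 ≡ x
    identity = solve-∀
  v-linear (suc k) = trans (v-step k) (trans (cong (_+ 2 * a) (v-linear k)) (identity (v 0) a k))
    where
    identity : ∀ x a k → x + 2 * a * k + 2 * a ≡ x + 2 * a * suc k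
    identity = solve-∀

  closed-form : ∀ k → u k + a * k ≡ a * (k * k) + k * v 0 + u 0
  closed-form zero    = identity (u 0) (v 0) a
    where
    identity : ∀ x y a → x + a * 0 ≡ a * (0 * 0) + 0 * y + x
    identity = solve-∀
  closed-form (suc k) = begin
    u (suc k) + a * suc k                                ≡⟨ cong (_+ a * suc k) (u-step k) ⟩
    v k + u k + a * suc k                                ≡⟨ regroup (v k) (u k) a k ⟩
    v k + (u k + a * k) + a                              ≡⟨ cong₂ (λ x y → x + y + a) (v-linear k) (closed-form k) ⟩
    v 0 + 2 * a * k + (a * (k * k) + k * v 0 + u 0) + a  ≡⟨ expand (u 0) (v 0) a k ⟩
    a * (suc k * suc k) + suc k * v 0 + u 0              ∎
    where
    open ≡-Reasoning
    regroup : ∀ x y a k → x + y + a * suc k ≡ x + (y + a * k) + a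
    regroup = solve-∀
    expand : ∀ x y a k → y + 2 * a * k + (a * (k * k) + k * y + x) + a ≡ a * (suc k * suc k) + suc k * y + x
    expand = solve-∀

  lower-bound : ∀ {β γ} → γ < u 0 → β + a ≤ v 0 → ∀ k → a * (k * k) + β * k + γ < u k
  lower-bound {β} {γ} γ<u₀ β+a≤v₀ k = +-cancelʳ-≤ (a * k) _ _ (begin
    suc (a * (k * k) + β * k + γ) + a * k   ≡⟨ regroup a β γ k ⟩
    a * (k * k) + k * (β + a) + suc γ       ≤⟨ +-mono-≤ (+-monoʳ-≤ (a * (k * k)) (*-monoʳ-≤ k β+a≤v₀)) γ<u₀ ⟩
    a * (k * k) + k * v 0 + u 0             ≡⟨ closed-form k ⟨
    u k + a * k                             ∎)
    where
    open ≤-Reasoning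
    regroup : ∀ a β γ k → suc (a * (k * k) + β * k + γ) + a * k ≡ a * (k * k) + k * (β + a) + suc γ
    regroup = solve-∀

  upper-bound : ∀ {β γ} → u 0 ≤ γ → v 0 ≤ β + a → ∀ k → u k ≤ a * (k * k) + β * k + γ
  upper-bound {β} {γ} u₀≤γ v₀≤β+a k = +-cancelʳ-≤ (a * k) _ _ (begin
    u k + a * k                             ≡⟨ closed-form k ⟩
    a * (k * k) + k * v 0 + u 0             ≤⟨ +-mono-≤ (+-monoʳ-≤ (a * (k * k)) (*-monoʳ-≤ k v₀≤β+a)) u₀≤γ ⟩
    a * (k * k) + k * (β + a) + γ           ≡⟨ regroup a β γ k ⟩
    a * (k * k) + β * k + γ + a * k         ∎)
    where
    open ≤-Reasoning
    regroup : ∀ a β γ k → a * (k * k) + k * (β + a) + γ ≡ a * (k * k) + β * k + γ + a * k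
    regroup = solve-∀

210*suc : ∀ k c → 210 * suc k + c ≡ 210 + (210 * k + c)
210*suc = solve-∀

module Progression (c : ℕ) = ConstantSecondDifference 7 (λ k → d₃ (210 * k + c)) (λ k → Δ (210 * k + c))
  (λ k → trans (cong d₃ (210*suc k c)) (d₃-period (210 * k + c)))
  (λ k → trans (cong Δ (210*suc k c)) (Δ-period (210 * k + c)))

Seed : (i c β γ : ℕ) → Set
Seed i c β γ = c % 10 ≡ i × 10 ≤ c × γ < d₃ c × β + 7 ≤ Δ c × d₃ (c ∸ 10) ≤ γ × Δ (c ∸ 10) ≤ β + 7

seed? : ∀ i c β γ → Dec (Seed i c β γ)
seed? i c β γ =
  c % 10 ≟ i ×-dec 10 ≤? c ×-dec
  γ <? d₃ c ×-dec β + 7 ≤? Δ c ×-dec d₃ (c ∸ 10) ≤? γ ×-dec Δ (c ∸ 10) ≤? β + 7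

isM-along : ∀ {i c β γ} k → Seed i c β γ → IsM i (7 * (k * k) + β * k + γ) (210 * k + c)
isM-along {i} {c} {β} {γ} k (c%10≡i , 10≤c , γ<d₃c , β+7≤Δc , d₃[c-10]≤γ , Δ[c-10]≤β+7) =
  residue , more-than-p , at-most-p-below
  where
  residue : (210 * k + c) % 10 ≡ i
  residue = trans (cong (_% 10) (shuffle k c)) (trans ([m+kn]%n≡m%n c (21 * k) 10) c%10≡i)
    where
    shuffle : ∀ k c → 210 * k + c ≡ c + 21 * k * 10
    shuffle = solve-∀
  more-than-p : 7 * (k * k) + β * k + γ < d (210 * k + c)
  more-than-p = subst (7 * (k * k) + β * k + γ <_) (sym (d≡d₃ (210 * k + c)))
                      (Progression.lower-bound c γ<d₃c β+7≤Δc k)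
  at-most-p-below : 10 ≤ 210 * k + c → d (210 * k + c ∸ 10) ≤ 7 * (k * k) + β * k + γ
  at-most-p-below _ = subst (_≤ 7 * (k * k) + β * k + γ)
                            (sym (trans (d≡d₃ (210 * k + c ∸ 10)) (cong d₃ (+-∸-assoc (210 * k) 10≤c))))
                            (Progression.upper-bound (c ∸ 10) d₃[c-10]≤γ Δ[c-10]≤β+7 k)

data Offset : Set where
  up down : ℕ → Offset

infixl 6 _⊕_
_⊕_ : ℕ → Offset → ℕ
x ⊕ up o   = x + o
x ⊕ down o = x ∸ o

∸-pos⇒≥ : ∀ m n → 0 < m ∸ n → n ≤ m
∸-pos⇒≥ m n pos = <⇒≤ (m∸n≢0⇒n<m {m} {n} (m<n⇒n≢0 pos))

⊕-∸-+ : ∀ o y b s → 0 < b ⊕ o ∸ s → (y + b) ⊕ o ∸ s ≡ y + (b ⊕ o ∸ s)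
⊕-∸-+ (up o)   y b s pos = trans (cong (_∸ s) (+-assoc y b o)) (+-∸-assoc y (∸-pos⇒≥ (b + o) s pos))
⊕-∸-+ (down o) y b s pos =
  trans (cong (_∸ s) (+-∸-assoc y (∸-pos⇒≥ b o (<-≤-trans pos (m∸n≤m (b ∸ o) s)))))
        (+-∸-assoc y (∸-pos⇒≥ (b ∸ o) s pos))

Minimum : (p s x : ℕ) → ℕ × Offset → Set
Minimum p s x (i , o) = IsM i p (x ⊕ o ∸ s)

Minima : List⁺ (ℕ × Offset) → (p s x : ℕ) → Set
Minima table p s x = foldr (λ e → Minimum p s x e ×_) (Minimum p s x) table

minima : ∀ table {p s x} → All.All (Minimum p s x) (toList table) → Minima table p s x
minima (e ∷ es) {p} {s} {x} (m ∷ ms) = go e es m ms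
  where
  go : ∀ e es → Minimum p s x e → All.All (Minimum p s x) es → Minima (e ∷ es) p s x
  go e []        m []        = m
  go e (e′ ∷ es) m (m′ ∷ ms) = m , go e′ es m′ ms

isM? : ∀ i p M → Dec (IsM i p M)
isM? i p M = map′ from-d₃ to-d₃ (M % 10 ≟ i ×-dec p <? d₃ M ×-dec (10 ≤? M →-dec d₃ (M ∸ 10) ≤? p))
  where
  from-d₃ : M % 10 ≡ i × p < d₃ M × (10 ≤ M → d₃ (M ∸ 10) ≤ p) → IsM i p M
  from-d₃ (res , more , below) = res , subst (p <_) (sym (d≡d₃ M)) more ,
                                 λ 10≤M → subst (_≤ p) (sym (d≡d₃ (M ∸ 10))) (below 10≤M)
  to-d₃ : IsM i p M → M % 10 ≡ i × p < d₃ M × (10 ≤ M → d₃ (M ∸ 10) ≤ p)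
  to-d₃ (res , more , below) = res , subst (p <_) (d≡d₃ M) more ,
                               λ 10≤M → subst (_≤ p) (d≡d₃ (M ∸ 10)) (below 10≤M)

minimum? : ∀ p s x → Decidable (Minimum p s x)
minimum? p s x (i , o) = isM? i p (x ⊕ o ∸ s)

minima-by-computation : ∀ table {p s x} → True (All.all? (minimum? p s x) (toList table)) → Minima table p s x
minima-by-computation table {p} {s} {x} ok = minima table {p} {s} {x} (toWitness ok)

SeedAt : (b s β γ : ℕ) → ℕ × Offset → Set
SeedAt b s β γ (i , o) = Seed i (b ⊕ o ∸ s) β γ

seedAt? : ∀ b s β γ → Decidable (SeedAt b s β γ)
seedAt? b s β γ (i , o) = seed? i (b ⊕ o ∸ s) β γ

105*[2k+r] : ∀ k r → 105 * (2 * k + r) ≡ 210 * k + 105 * r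
105*[2k+r] = solve-∀

minima-along : ∀ table {p} s k r β γ → p ≡ 7 * (k * k) + β * k + γ →
  True (All.all? (seedAt? (105 * r) s β γ) (toList table)) → Minima table p s (105 * (2 * k + r))
minima-along table {p} s k r β γ p≡ seeds =
  minima table {p} {s} {105 * (2 * k + r)} (All.map (λ {e} → entry e) (toWitness seeds))
  where
  entry : ∀ e → SeedAt (105 * r) s β γ e → Minimum p s (105 * (2 * k + r)) e
  entry (i , o) seed@(_ , 10≤c , _) =
    subst₂ (IsM i) (sym p≡) (sym M≡) (isM-along {i} {105 * r ⊕ o ∸ s} {β} {γ} k seed)
    where
    M≡ : 105 * (2 * k + r) ⊕ o ∸ s ≡ 210 * k + (105 * r ⊕ o ∸ s)
    M≡ = trans (cong (λ x → x ⊕ o ∸ s) (105*[2k+r] k r))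
               (⊕-∸-+ o (210 * k) (105 * r) s (<-≤-trans (s≤s z≤n) 10≤c))

tableA tableB tableD : List⁺ (ℕ × Offset)
tableA = (9 , up 99) ∷ (4 , up 84) ∷ (8 , up 78) ∷ (3 , up 63) ∷ (7 , up 57) ∷
         (2 , up 42) ∷ (6 , up 36) ∷ (1 , up 21) ∷ (5 , up 15) ∷ (0 , down 0) ∷ []
tableB = (4 , up 99) ∷ (9 , up 84) ∷ (3 , up 78) ∷ (8 , up 63) ∷ (2 , up 57) ∷
         (7 , up 42) ∷ (1 , up 36) ∷ (6 , up 21) ∷ (0 , up 15) ∷ (5 , down 0) ∷ []
tableD = (9 , up 54) ∷ (4 , up 39) ∷ (8 , up 33) ∷ (3 , up 18) ∷ (7 , up 12) ∷
         (2 , down 3) ∷ (6 , down 9) ∷ (1 , down 24) ∷ (5 , down 30) ∷ (0 , down 45) ∷ []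

rₑ rₒ rₒₒ : ℕ → ℕ → ℕ
rₑ n j = (n * (7 * n + 8 ∸ 2 * j)) / 4
rₒ n j = (7 * n * n + 8 * n + 1 ∸ 4 * j * n) / 4
rₒₒ n j = (7 * n * n + 2 * n ∸ 4 * j * n ∸ 1) / 4

exact-quotient : ∀ {x y q} → x ≡ q * 4 + y → (x ∸ y) / 4 ≡ q
exact-quotient {x} {y} {q} x≡ =
  trans (cong (λ t → (t ∸ y) / 4) x≡) (trans (cong (_/ 4) (m+n∸n≡m (q * 4) y)) (m*n/n≡m q 4))

rₑ-value : ∀ k j u → j + u ≡ 11 → rₑ (2 * k + 2) j ≡ 7 * (k * k) + (7 + u) * k + u
rₑ-value k j u j+u≡11 = begin
  (n * (7 * n + 8 ∸ 2 * j)) / 4         ≡⟨ cong (_/ 4) (*-distribˡ-∸ n (7 * n + 8) (2 * j)) ⟩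
  (n * (7 * n + 8) ∸ n * (2 * j)) / 4   ≡⟨ exact-quotient numerator ⟩
  7 * (k * k) + (7 + u) * k + u         ∎
  where
  open ≡-Reasoning
  n = 2 * k + 2
  expand : ∀ k → (2 * k + 2) * (7 * (2 * k + 2) + 8) ≡ 28 * (k * k) + 28 * k + (4 * k + 4) * 11
  expand = solve-∀
  regroup : ∀ k j u → 28 * (k * k) + 28 * k + (4 * k + 4) * (j + u)
                      ≡ (7 * (k * k) + (7 + u) * k + u) * 4 + (2 * k + 2) * (2 * j)
  regroup = solve-∀
  numerator : n * (7 * n + 8) ≡ (7 * (k * k) + (7 + u) * k + u) * 4 + n * (2 * j)
  numerator = begin
    n * (7 * n + 8)                                   ≡⟨ expand k ⟩
    28 * (k * k) + 28 * k + (4 * k + 4) * 11          ≡⟨ cong (λ t → 28 * (k * k) + 28 * k + (4 * k + 4) * t) (sym j+u≡11) ⟩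
    28 * (k * k) + 28 * k + (4 * k + 4) * (j + u)     ≡⟨ regroup k j u ⟩
    (7 * (k * k) + (7 + u) * k + u) * 4 + n * (2 * j) ∎

rₒ-value : ∀ k j u → j + u ≡ 4 → rₒ (2 * k + 3) j ≡ 7 * (k * k) + (17 + 2 * u) * k + (10 + 3 * u)
rₒ-value k j u j+u≡4 = exact-quotient (begin
  7 * n * n + 8 * n + 1                                             ≡⟨ expand k ⟩
  28 * (k * k) + 68 * k + 40 + (8 * k + 12) * 4                     ≡⟨ cong (λ t → 28 * (k * k) + 68 * k + 40 + (8 * k + 12) * t) (sym j+u≡4) ⟩
  28 * (k * k) + 68 * k + 40 + (8 * k + 12) * (j + u)               ≡⟨ regroup k j u ⟩
  (7 * (k * k) + (17 + 2 * u) * k + (10 + 3 * u)) * 4 + 4 * j * n   ∎)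
  where
  open ≡-Reasoning
  n = 2 * k + 3
  expand : ∀ k → 7 * (2 * k + 3) * (2 * k + 3) + 8 * (2 * k + 3) + 1 ≡ 28 * (k * k) + 68 * k + 40 + (8 * k + 12) * 4
  expand = solve-∀
  regroup : ∀ k j u → 28 * (k * k) + 68 * k + 40 + (8 * k + 12) * (j + u)
                      ≡ (7 * (k * k) + (17 + 2 * u) * k + (10 + 3 * u)) * 4 + 4 * j * (2 * k + 3)
  regroup = solve-∀

rₒₒ-value : ∀ k j u → j + u ≡ 1 → rₒₒ (2 * k + 1) j ≡ 7 * (k * k) + (6 + 2 * u) * k + (1 + u)
rₒₒ-value k j u j+u≡1 = begin
  (7 * n * n + 2 * n ∸ 4 * j * n ∸ 1) / 4     ≡⟨ cong (_/ 4) (∸-+-assoc (7 * n * n + 2 * n) (4 * j * n) 1) ⟩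
  (7 * n * n + 2 * n ∸ (4 * j * n + 1)) / 4   ≡⟨ exact-quotient numerator ⟩
  7 * (k * k) + (6 + 2 * u) * k + (1 + u)     ∎
  where
  open ≡-Reasoning
  n = 2 * k + 1
  expand : ∀ k → 7 * (2 * k + 1) * (2 * k + 1) + 2 * (2 * k + 1) ≡ 28 * (k * k) + 24 * k + 5 + (8 * k + 4) * 1
  expand = solve-∀
  regroup : ∀ k j u → 28 * (k * k) + 24 * k + 5 + (8 * k + 4) * (j + u)
                      ≡ (7 * (k * k) + (6 + 2 * u) * k + (1 + u)) * 4 + (4 * j * (2 * k + 1) + 1)
  regroup = solve-∀
  numerator : 7 * n * n + 2 * n ≡ (7 * (k * k) + (6 + 2 * u) * k + (1 + u)) * 4 + (4 * j * n + 1)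
  numerator = begin
    7 * n * n + 2 * n                                                ≡⟨ expand k ⟩
    28 * (k * k) + 24 * k + 5 + (8 * k + 4) * 1                      ≡⟨ cong (λ t → 28 * (k * k) + 24 * k + 5 + (8 * k + 4) * t) (sym j+u≡1) ⟩
    28 * (k * k) + 24 * k + 5 + (8 * k + 4) * (j + u)                ≡⟨ regroup k j u ⟩
    (7 * (k * k) + (6 + 2 * u) * k + (1 + u)) * 4 + (4 * j * n + 1)  ∎

halves : ∀ n {r} → n % 2 ≡ r → ∃[ h ] n ≡ r + h * 2
halves n n%2≡r = n / 2 , trans (m≡m%n+[m/n]*n n 2) (cong (_+ n / 2 * 2) n%2≡r)

even-split : ∀ n → n % 2 ≡ 0 → n ≡ 0 ⊎ ∃[ k ] n ≡ 2 * k + 2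
even-split n even with halves n even
... | zero  , n≡0 = inj₁ n≡0
... | suc k , n≡  = inj₂ (k , trans n≡ (regroup k))
  where
  regroup : ∀ k → suc k * 2 ≡ 2 * k + 2
  regroup = solve-∀

odd-split : ∀ n → n % 2 ≡ 1 → n ≡ 1 ⊎ ∃[ k ] n ≡ 2 * k + 3
odd-split n odd with halves n odd
... | zero  , n≡1 = inj₁ n≡1
... | suc k , n≡  = inj₂ (k , trans n≡ (regroup k))
  where
  regroup : ∀ k → 1 + suc k * 2 ≡ 2 * k + 3
  regroup = solve-∀

odd-form : ∀ n → n % 2 ≡ 1 → ∃[ k ] n ≡ 2 * k + 1
odd-form n odd with halves n odd
... | k , n≡ = k , trans n≡ (regroup k)
  where
  regroup : ∀ k → 1 + k * 2 ≡ 2 * k + 1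
  regroup = solve-∀

even-split≥2 : ∀ n → n % 2 ≡ 0 → 2 ≤ n → ∃[ k ] n ≡ 2 * k + 2
even-split≥2 n even 2≤n with even-split n even
... | inj₁ refl = contradiction 2≤n λ ()
... | inj₂ split = split

odd-split≥3 : ∀ n → n % 2 ≡ 1 → 3 ≤ n → ∃[ k ] n ≡ 2 * k + 3
odd-split≥3 n odd 3≤n with odd-split n odd
... | inj₁ refl = contradiction 3≤n λ { (s≤s ()) }
... | inj₂ split = split

minimaₑ : ∀ table {n} k j u → n ≡ 2 * k + 2 → j + u ≡ 11 →
          True (All.all? (seedAt? (105 * 2) (15 * j) (7 + u) u) (toList table)) →
          Minima table (rₑ n j) (15 * j) (105 * n)
minimaₑ table k j u n≡ j+u≡11 seeds = subst (λ n → Minima table (rₑ n j) (15 * j) (105 * n)) (sym n≡)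
  (minima-along table (15 * j) k 2 (7 + u) u (rₑ-value k j u j+u≡11) seeds)

minimaₒ : ∀ table {n} k j u → n ≡ 2 * k + 3 → j + u ≡ 4 →
          True (All.all? (seedAt? (105 * 3) (30 * j) (17 + 2 * u) (10 + 3 * u)) (toList table)) →
          Minima table (rₒ n j) (30 * j) (105 * n)
minimaₒ table k j u n≡ j+u≡4 seeds = subst (λ n → Minima table (rₒ n j) (30 * j) (105 * n)) (sym n≡)
  (minima-along table (30 * j) k 3 (17 + 2 * u) (10 + 3 * u) (rₒ-value k j u j+u≡4) seeds)

minimaₒₒ : ∀ table {n} k j u → n ≡ 2 * k + 1 → j + u ≡ 1 →
           True (All.all? (seedAt? (105 * 1) (30 * j) (6 + 2 * u) (1 + u)) (toList table)) →
           Minima table (rₒₒ n j) (30 * j) (105 * n)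
minimaₒₒ table k j u n≡ j+u≡1 seeds = subst (λ n → Minima table (rₒₒ n j) (30 * j) (105 * n)) (sym n≡)
  (minima-along table (30 * j) k 1 (6 + 2 * u) (1 + u) (rₒₒ-value k j u j+u≡1) seeds)

part-a : ∀ n j → n % 2 ≡ 0 → (j ≡ 0 ⊎ (2 ≤ n × (j ≡ 2 ⊎ j ≡ 4 ⊎ j ≡ 6 ⊎ j ≡ 8))) →
         Minima tableA (rₑ n j) (15 * j) (105 * n)
part-a n j even (inj₁ refl) with even-split n even
... | inj₁ n≡0      = subst (λ n → Minima tableA (rₑ n 0) (15 * 0) (105 * n)) (sym n≡0)
                        (minima-by-computation tableA {rₑ 0 0} {15 * 0} {105 * 0} tt)
... | inj₂ (k , n≡) = minimaₑ tableA k 0 11 n≡ refl tt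
part-a n j even (inj₂ (2≤n , j-cases)) with even-split≥2 n even 2≤n | j-cases
... | k , n≡ | inj₁ refl                     = minimaₑ tableA k 2 9 n≡ refl tt
... | k , n≡ | inj₂ (inj₁ refl)              = minimaₑ tableA k 4 7 n≡ refl tt
... | k , n≡ | inj₂ (inj₂ (inj₁ refl))       = minimaₑ tableA k 6 5 n≡ refl tt
... | k , n≡ | inj₂ (inj₂ (inj₂ refl))       = minimaₑ tableA k 8 3 n≡ refl tt

part-b : ∀ n j → n % 2 ≡ 0 → 2 ≤ n → (j ≡ 3 ⊎ j ≡ 5) → Minima tableB (rₑ n j) (15 * j) (105 * n)
part-b n j even 2≤n j-cases with even-split≥2 n even 2≤n | j-cases
... | k , n≡ | inj₁ refl = minimaₑ tableB k 3 8 n≡ refl tt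
... | k , n≡ | inj₂ refl = minimaₑ tableB k 5 6 n≡ refl tt

part-c : ∀ n j → n % 2 ≡ 1 → ((1 ≤ n × j ≡ 0) ⊎ (3 ≤ n × (j ≡ 1 ⊎ j ≡ 2 ⊎ j ≡ 3 ⊎ j ≡ 4))) →
         Minima tableB (rₒ n j) (30 * j) (105 * n)
part-c n j odd (inj₁ (_ , refl)) with odd-split n odd
... | inj₁ n≡1      = subst (λ n → Minima tableB (rₒ n 0) (30 * 0) (105 * n)) (sym n≡1)
                        (minima-by-computation tableB {rₒ 1 0} {30 * 0} {105 * 1} tt)
... | inj₂ (k , n≡) = minimaₒ tableB k 0 4 n≡ refl tt
part-c n j odd (inj₂ (3≤n , j-cases)) with odd-split≥3 n odd 3≤n | j-cases
... | k , n≡ | inj₁ refl                     = minimaₒ tableB k 1 3 n≡ refl tt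
... | k , n≡ | inj₂ (inj₁ refl)              = minimaₒ tableB k 2 2 n≡ refl tt
... | k , n≡ | inj₂ (inj₂ (inj₁ refl))       = minimaₒ tableB k 3 1 n≡ refl tt
... | k , n≡ | inj₂ (inj₂ (inj₂ refl))       = minimaₒ tableB k 4 0 n≡ refl tt

part-d : ∀ n j → n % 2 ≡ 1 → 1 ≤ n → (j ≡ 0 ⊎ j ≡ 1) → Minima tableD (rₒₒ n j) (30 * j) (105 * n)
part-d n j odd _ j-cases with odd-form n odd | j-cases
... | k , n≡ | inj₁ refl = minimaₒₒ tableD k 0 1 n≡ refl tt
... | k , n≡ | inj₂ refl = minimaₒₒ tableD k 1 0 n≡ refl tt

lemma5 :
  ((n j : ℕ) → n % 2 ≡ 0 →
    ((j ≡ 0) ⊎ (2 ≤ n × (j ≡ 2 ⊎ j ≡ 4 ⊎ j ≡ 6 ⊎ j ≡ 8))) →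
    IsM 9 ((n * (7 * n + 8 ∸ 2 * j)) / 4) (105 * n + 99 ∸ 15 * j) ×
    IsM 4 ((n * (7 * n + 8 ∸ 2 * j)) / 4) (105 * n + 84 ∸ 15 * j) ×
    IsM 8 ((n * (7 * n + 8 ∸ 2 * j)) / 4) (105 * n + 78 ∸ 15 * j) ×
    IsM 3 ((n * (7 * n + 8 ∸ 2 * j)) / 4) (105 * n + 63 ∸ 15 * j) ×
    IsM 7 ((n * (7 * n + 8 ∸ 2 * j)) / 4) (105 * n + 57 ∸ 15 * j) ×
    IsM 2 ((n * (7 * n + 8 ∸ 2 * j)) / 4) (105 * n + 42 ∸ 15 * j) ×
    IsM 6 ((n * (7 * n + 8 ∸ 2 * j)) / 4) (105 * n + 36 ∸ 15 * j) ×
    IsM 1 ((n * (7 * n + 8 ∸ 2 * j)) / 4) (105 * n + 21 ∸ 15 * j) ×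
    IsM 5 ((n * (7 * n + 8 ∸ 2 * j)) / 4) (105 * n + 15 ∸ 15 * j) ×
    IsM 0 ((n * (7 * n + 8 ∸ 2 * j)) / 4) (105 * n ∸ 15 * j))
  ×
  ((n j : ℕ) → n % 2 ≡ 0 → 2 ≤ n → (j ≡ 3 ⊎ j ≡ 5) →
    IsM 4 ((n * (7 * n + 8 ∸ 2 * j)) / 4) (105 * n + 99 ∸ 15 * j) ×
    IsM 9 ((n * (7 * n + 8 ∸ 2 * j)) / 4) (105 * n + 84 ∸ 15 * j) ×
    IsM 3 ((n * (7 * n + 8 ∸ 2 * j)) / 4) (105 * n + 78 ∸ 15 * j) ×
    IsM 8 ((n * (7 * n + 8 ∸ 2 * j)) / 4) (105 * n + 63 ∸ 15 * j) ×
    IsM 2 ((n * (7 * n + 8 ∸ 2 * j)) / 4) (105 * n + 57 ∸ 15 * j) ×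
    IsM 7 ((n * (7 * n + 8 ∸ 2 * j)) / 4) (105 * n + 42 ∸ 15 * j) ×
    IsM 1 ((n * (7 * n + 8 ∸ 2 * j)) / 4) (105 * n + 36 ∸ 15 * j) ×
    IsM 6 ((n * (7 * n + 8 ∸ 2 * j)) / 4) (105 * n + 21 ∸ 15 * j) ×
    IsM 0 ((n * (7 * n + 8 ∸ 2 * j)) / 4) (105 * n + 15 ∸ 15 * j) ×
    IsM 5 ((n * (7 * n + 8 ∸ 2 * j)) / 4) (105 * n ∸ 15 * j))
  ×
  ((n j : ℕ) → n % 2 ≡ 1 →
    ((1 ≤ n × j ≡ 0) ⊎ (3 ≤ n × (j ≡ 1 ⊎ j ≡ 2 ⊎ j ≡ 3 ⊎ j ≡ 4))) →
    IsM 4 ((7 * n * n + 8 * n + 1 ∸ 4 * j * n) / 4) (105 * n + 99 ∸ 30 * j) ×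
    IsM 9 ((7 * n * n + 8 * n + 1 ∸ 4 * j * n) / 4) (105 * n + 84 ∸ 30 * j) ×
    IsM 3 ((7 * n * n + 8 * n + 1 ∸ 4 * j * n) / 4) (105 * n + 78 ∸ 30 * j) ×
    IsM 8 ((7 * n * n + 8 * n + 1 ∸ 4 * j * n) / 4) (105 * n + 63 ∸ 30 * j) ×
    IsM 2 ((7 * n * n + 8 * n + 1 ∸ 4 * j * n) / 4) (105 * n + 57 ∸ 30 * j) ×
    IsM 7 ((7 * n * n + 8 * n + 1 ∸ 4 * j * n) / 4) (105 * n + 42 ∸ 30 * j) ×
    IsM 1 ((7 * n * n + 8 * n + 1 ∸ 4 * j * n) / 4) (105 * n + 36 ∸ 30 * j) ×
    IsM 6 ((7 * n * n + 8 * n + 1 ∸ 4 * j * n) / 4) (105 * n + 21 ∸ 30 * j) ×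
    IsM 0 ((7 * n * n + 8 * n + 1 ∸ 4 * j * n) / 4) (105 * n + 15 ∸ 30 * j) ×
    IsM 5 ((7 * n * n + 8 * n + 1 ∸ 4 * j * n) / 4) (105 * n ∸ 30 * j))
  ×
  ((n j : ℕ) → n % 2 ≡ 1 → 1 ≤ n → (j ≡ 0 ⊎ j ≡ 1) →
    IsM 9 ((7 * n * n + 2 * n ∸ 4 * j * n ∸ 1) / 4) (105 * n + 54 ∸ 30 * j) ×
    IsM 4 ((7 * n * n + 2 * n ∸ 4 * j * n ∸ 1) / 4) (105 * n + 39 ∸ 30 * j) ×
    IsM 8 ((7 * n * n + 2 * n ∸ 4 * j * n ∸ 1) / 4) (105 * n + 33 ∸ 30 * j) ×
    IsM 3 ((7 * n * n + 2 * n ∸ 4 * j * n ∸ 1) / 4) (105 * n + 18 ∸ 30 * j) ×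
    IsM 7 ((7 * n * n + 2 * n ∸ 4 * j * n ∸ 1) / 4) (105 * n + 12 ∸ 30 * j) ×
    IsM 2 ((7 * n * n + 2 * n ∸ 4 * j * n ∸ 1) / 4) (105 * n ∸ 3 ∸ 30 * j) ×
    IsM 6 ((7 * n * n + 2 * n ∸ 4 * j * n ∸ 1) / 4) (105 * n ∸ 9 ∸ 30 * j) ×
    IsM 1 ((7 * n * n + 2 * n ∸ 4 * j * n ∸ 1) / 4) (105 * n ∸ 24 ∸ 30 * j) ×
    IsM 5 ((7 * n * n + 2 * n ∸ 4 * j * n ∸ 1) / 4) (105 * n ∸ 30 ∸ 30 * j) ×
    IsM 0 ((7 * n * n + 2 * n ∸ 4 * j * n ∸ 1) / 4) (105 * n ∸ 45 ∸ 30 * j))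
lemma5 = part-a , part-b , part-c , part-d
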